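{- Let $k$ be an arbitrary (complex) number, and let $(a_n)_{n\ge 0}$ be the sequence defined by \[ \sum_{n\ge 0} a_n x^n = \frac{1}{1-kx+kx^2-x^3} = \frac{1}{(1-x)(1-(k-1)x+x^2)}. \] Then $(a_n)$ is fixed by $\mathcal{L}$, that is, $a_n^2 - a_{n-1}a_{n+1} = a_n$ for all $n\ge 0$ (with $a_{ -1}=0$). Moreover $a_0=1$ and $a_1=k$.
   Context: For a sequence $(a_n)_{n\ge 0}$, $\mathcal{L}$ denotes the operator sending $(a_n)$ to the sequence $(a_n^2 - a_{n-1}a_{n+1})_{n\ge 0}$, with the convention $a_{ -1}=0$. A sequence is fixed by $\mathcal{L}$ if $\mathcal{L}(a_n)=(a_n)$. -}

module Defs where

open import Algebra.Bundles using (CommutativeRing)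
open import Data.Nat using (ℕ; zero; suc)
open import Level using (_⊔_)

-- Everything is stated over an arbitrary commutative ring R (the paper: ℂ).
module _ {c ℓ} (R : CommutativeRing c ℓ) where
  open CommutativeRing R

  -- sh a j n = a_{n-j}, with the convention a_m = 0 for m < 0.
  sh : (ℕ → Carrier) → ℕ → ℕ → Carrier
  sh a zero    n       = a n
  sh a (suc j) zero    = 0#
  sh a (suc j) (suc n) = sh a j n

  -- Kronecker delta at 0: coefficients of the power series 1.
  δ₀ : ℕ → Carrier
  δ₀ zero    = 1#
  δ₀ (suc n) = 0#

  -- n-th coefficient of (1 - k x + k x^2 - x^3) · Σ a_n x^n.
  cubicTimes : Carrier → (ℕ → Carrier) → ℕ → Carrier
  cubicTimes k a n = a n - k * sh a 1 n + k * sh a 2 n - sh a 3 n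

  -- Σ a_n x^n = 1 / (1 - k x + k x^2 - x^3) as formal power series.
  HasGF : Carrier → (ℕ → Carrier) → Set ℓ
  HasGF k a = ∀ n → cubicTimes k a n ≈ δ₀ n

  𝓛 : (ℕ → Carrier) → ℕ → Carrier
  𝓛 a n = a n * a n - sh a 1 n * a (suc n)

  FixedBy𝓛 : (ℕ → Carrier) → Set ℓ
  FixedBy𝓛 a = ∀ n → 𝓛 a n ≈ a n

module Submission where

-- Write A(x) = Σ aₙ xⁿ.  The generating function says
-- (1 - kx + kx² - x³) A = 1, and since 1 - kx + kx² - x³ = (1 - x)(1 - (k-1)x + x²)
-- we may "integrate once": (1 - (k-1)x + x²) A = 1/(1 - x), i.e. every coefficient
-- of the left side equals 1.  In additive form this is the first integral
--     a_{n-1} + a_{n+1} + a_n = k aₙ + 1            (n ≥ 0, a_{-1} = 0).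
-- For any sequence obeying  a_{n-1} + a_{n+1} + a_n = k aₙ + c  the Cassini-type
-- quantity aₙ² - a_{n-1} a_{n+1} - c aₙ does not depend on n; here c = 1 and its
-- value at n = 0 is a₀² - a₀ = 0, which is exactly the statement 𝓛(a) = a.

open import Algebra.Bundles using (CommutativeRing)
open import Data.Nat using (ℕ; zero; suc)
open import Data.Product using (_×_; _,_)
open import Defs
import Algebra.Properties.Group as GroupProperties
import Algebra.Solver.Ring.NaturalCoefficients.Default as NaturalSolver
import Relation.Binary.Reasoning.Setoid as SetoidReasoning

module Development {r ℓ} (R : CommutativeRing r ℓ) where
  open CommutativeRing R
  open GroupProperties +-group using (x≈z//y; //-rightDividesˡ; ∙-cancelʳ)
  open NaturalSolver commutativeSemiring using (solve; _:=_; _:+_; _:*_; con)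
  open SetoidReasoning setoid

  sub-to-sum : ∀ {x y z} → x - y ≈ z → x ≈ z + y
  sub-to-sum {x} {y} {z} eq = begin
    x           ≈⟨ //-rightDividesˡ y x ⟨
    (x - y) + y ≈⟨ +-congʳ eq ⟩
    z + y       ∎

  sum-to-sub : ∀ {x y z} → x ≈ z + y → x - y ≈ z
  sum-to-sub {x} {y} {z} eq = sym (x≈z//y z y x (sym eq))

  -- Multiplying the two first integrals by z and y makes both sides equal to kyz + ….
  cassini-step : ∀ {k c u y z w} →
                 u + z + y ≈ k * y + c → y + w + z ≈ k * z + c →
                 y * y - u * z ≈ c * y → z * z - y * w ≈ c * z
  cassini-step {k} {c} {u} {y} {z} {w} integral₁ integral₂ invariant =
    sum-to-sub (∙-cancelʳ (u * z + y * z + c * y) (z * z) (c * z + y * w) shifted)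
    where
    shifted : z * z + (u * z + y * z + c * y) ≈ (c * z + y * w) + (u * z + y * z + c * y)
    shifted = begin
      z * z + (u * z + y * z + c * y)
        ≈⟨ solve 6 (λ u y z w k c → z :* z :+ (u :* z :+ y :* z :+ c :* y)
                                  := z :* (u :+ z :+ y) :+ c :* y) refl u y z w k c ⟩
      z * (u + z + y) + c * y
        ≈⟨ +-congʳ (*-congˡ integral₁) ⟩
      z * (k * y + c) + c * y
        ≈⟨ solve 6 (λ u y z w k c → z :* (k :* y :+ c) :+ c :* y
                                  := y :* (k :* z :+ c) :+ c :* z) refl u y z w k c ⟩
      y * (k * z + c) + c * z
        ≈⟨ +-congʳ (*-congˡ integral₂) ⟨
      y * (y + w + z) + c * z
        ≈⟨ solve 6 (λ u y z w k c → y :* (y :+ w :+ z) :+ c :* z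
                                  := y :* y :+ (y :* w :+ y :* z :+ c :* z)) refl u y z w k c ⟩
      y * y + (y * w + y * z + c * z)
        ≈⟨ +-congʳ (sub-to-sum invariant) ⟩
      (c * y + u * z) + (y * w + y * z + c * z)
        ≈⟨ solve 6 (λ u y z w k c → (c :* y :+ u :* z) :+ (y :* w :+ y :* z :+ c :* z)
                                  := (c :* z :+ y :* w) :+ (u :* z :+ y :* z :+ c :* y)) refl u y z w k c ⟩
      (c * z + y * w) + (u * z + y * z + c * y) ∎

  𝓛-linear : ∀ (a : ℕ → Carrier) k c →
             (∀ n → sh R a 1 n + a (suc n) + a n ≈ k * a n + c) →
             𝓛 R a 0 ≈ c * a 0 → ∀ n → 𝓛 R a n ≈ c * a n
  𝓛-linear a k c integral base zero    = base
  𝓛-linear a k c integral base (suc n) =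
    cassini-step (integral n) (integral (suc n)) (𝓛-linear a k c integral base n)

  module Sequence (k : Carrier) (a : ℕ → Carrier) (gf : HasGF R k a) where

    -- The defining recurrence with subtractions cleared:
    -- aₙ + k a_{n-2} = δ₀(n) + a_{n-3} + k a_{n-1}.
    recurrence : ∀ n → a n + k * sh R a 2 n ≈ (δ₀ R n + sh R a 3 n) + k * sh R a 1 n
    recurrence n = begin
      a n + k * a₂
        ≈⟨ +-congʳ (sub-to-sum refl) ⟩
      ((a n - k * a₁) + k * a₁) + k * a₂
        ≈⟨ solve 3 (λ t q r → (t :+ q) :+ r := (t :+ r) :+ q) refl (a n - k * a₁) (k * a₁) (k * a₂) ⟩
      ((a n - k * a₁) + k * a₂) + k * a₁
        ≈⟨ +-congʳ (sub-to-sum (gf n)) ⟩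
      (δ₀ R n + sh R a 3 n) + k * a₁ ∎
      where a₁ = sh R a 1 n ; a₂ = sh R a 2 n

    a₀≈1 : a 0 ≈ 1#
    a₀≈1 = begin
      a 0                   ≈⟨ solve 2 (λ x k → x := x :+ k :* con 0) refl (a 0) k ⟩
      a 0 + k * 0#          ≈⟨ recurrence 0 ⟩
      (1# + 0#) + k * 0#    ≈⟨ solve 1 (λ k → (con 1 :+ con 0) :+ k :* con 0 := con 1) refl k ⟩
      1#                    ∎

    a₁≈ka₀ : a 1 ≈ k * a 0
    a₁≈ka₀ = begin
      a 1                   ≈⟨ solve 2 (λ x k → x := x :+ k :* con 0) refl (a 1) k ⟩
      a 1 + k * 0#          ≈⟨ recurrence 1 ⟩
      (0# + 0#) + k * a 0   ≈⟨ solve 2 (λ x k → (con 0 :+ con 0) :+ k :* x := k :* x) refl (a 0) k ⟩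
      k * a 0               ∎

    a₁≈k : a 1 ≈ k
    a₁≈k = trans a₁≈ka₀ (trans (*-congˡ a₀≈1) (*-identityʳ k))

    -- First integral, the coefficientwise form of (1 - (k-1)x + x²) A = 1/(1 - x):
    -- a_{n-1} + a_{n+1} + aₙ = k aₙ + 1.  Induction: adding the recurrence at n + 2
    -- to the case n telescopes, after cancelling the common term a_{n-1} + k aₙ.
    first-integral : ∀ n → sh R a 1 n + a (suc n) + a n ≈ k * a n + 1#
    first-integral zero = begin
      0# + a 1 + a 0        ≈⟨ +-cong (+-congˡ a₁≈ka₀) a₀≈1 ⟩
      0# + k * a 0 + 1#     ≈⟨ solve 2 (λ x k → con 0 :+ k :* x :+ con 1 := k :* x :+ con 1) refl (a 0) k ⟩
      k * a 0 + 1#          ∎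
    first-integral (suc n) = ∙-cancelʳ (x + k * y) (y + w + z) (k * z + 1#) (begin
      (y + w + z) + (x + k * y)
        ≈⟨ solve 5 (λ x y z w k → (y :+ w :+ z) :+ (x :+ k :* y)
                                := (x :+ z :+ y) :+ (w :+ k :* y)) refl x y z w k ⟩
      (x + z + y) + (w + k * y)
        ≈⟨ +-cong (first-integral n) (recurrence (suc (suc n))) ⟩
      (k * y + 1#) + ((0# + x) + k * z)
        ≈⟨ solve 5 (λ x y z w k → (k :* y :+ con 1) :+ ((con 0 :+ x) :+ k :* z)
                                := (k :* z :+ con 1) :+ (x :+ k :* y)) refl x y z w k ⟩
      (k * z + 1#) + (x + k * y) ∎)
      where x = sh R a 1 n ; y = a n ; z = a (suc n) ; w = a (suc (suc n))

    𝓛-at-0 : 𝓛 R a 0 ≈ 1# * a 0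
    𝓛-at-0 = sum-to-sub (begin
      a 0 * a 0             ≈⟨ *-congʳ a₀≈1 ⟩
      1# * a 0              ≈⟨ solve 2 (λ x y → con 1 :* x := con 1 :* x :+ con 0 :* y) refl (a 0) (a 1) ⟩
      1# * a 0 + 0# * a 1   ∎)

    fixed : FixedBy𝓛 R a
    fixed n = trans (𝓛-linear a k 1# first-integral 𝓛-at-0 n) (*-identityˡ (a n))

theorem3p3 : ∀ {c ℓ} (R : CommutativeRing c ℓ) (k : CommutativeRing.Carrier R)
               (a : ℕ → CommutativeRing.Carrier R) →
               HasGF R k a →
               FixedBy𝓛 R a
               × CommutativeRing._≈_ R (a 0) (CommutativeRing.1# R)
               × CommutativeRing._≈_ R (a 1) k
theorem3p3 R k a gf = fixed , a₀≈1 , a₁≈k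
  where open Development.Sequence R k a gf
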